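{- For each $n<\omega$, every formula $A\in\mathcal{F}^\nabla_n$ is equivalent in $\mathrm{RC}^\nabla$ to a formula of the form $\nabla_nA_n\land\nabla_{n+1}A_{n+1}\land\dots\land\nabla_{n+k}A_{n+k}$ for some $k<\omega$, where $A_i\in\mathcal{W}_i$ for all $i=n,\dots,n+k$.
   Context: Strictly positive formulas are built from propositional variables and $\top$ by $\land$ and unary modalities $\Diamond_n,\nabla_n$ ($n<\omega$). $\mathcal{F}^\nabla_n$ is the set of variable-free strictly positive formulas using only modalities $\Diamond_i,\nabla_i$ with $i\ge n$. A word is a formula $\Diamond_{j_1}\cdots\Diamond_{j_r}\top$ (only $\Diamond$-modalities, no $\land$); $\mathcal{W}_i$ is the set of words with all $j_s\ge i$. $\mathrm{RC}^\nabla$ is the smallest set of sequents $A\vdash B$ containing the following axioms and closed under the following rules and under substitution: (1) $A\vdash A$; $A\vdash\top$; $A\land B\vdash A$; $A\land B\vdash B$; from $A\vdash B$, $B\vdash C$ infer $A\vdash C$; from $A\vdash B$, $A\vdash C$ infer $A\vdash B\land C$; from $A\vdash B$ infer $aA\vdash aB$ for each modality $a$; (2) $aaA\vdash aA$ for each modality $a$; (3) for $m<n$: $\Diamond_nA\vdash\Diamond_mA$, $\Diamond_nA\land\Diamond_mB\vdash\Diamond_n(A\land\Diamond_mB)$, and the same two with $\nabla$ in place of $\Diamond$; (4) $A\vdash\nabla_nA$, $\Diamond_nA\vdash\nabla_nA$; (5) for $m\le n$: $\Diamond_m\nabla_nA\vdash\Diamond_mA$, $\nabla_n\Diamond_mA\vdash\Diamond_mA$.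 Equivalence means provability of both directions. -}

module Defs where

open import Data.Nat using (ℕ; zero; suc; _<_; _≤_; _+_)
open import Data.List using (List; []; _∷_)
open import Data.List.Relation.Unary.All using (All)
open import Data.Product using (_×_; Σ; _,_)

data Mod : Set where
  ◇ : ℕ → Mod
  ∇ : ℕ → Mod

data Fm : Set where
  var : ℕ → Fm
  ⊤'  : Fm
  _∧'_ : Fm → Fm → Fm
  ⟨_⟩_ : Mod → Fm → Fm

infixr 6 _∧'_
infixr 7 ⟨_⟩_

sub : (ℕ → Fm) → Fm → Fm
sub σ (var x) = σ x
sub σ ⊤' = ⊤'
sub σ (A ∧' B) = sub σ A ∧' sub σ B
sub σ (⟨ a ⟩ A) = ⟨ a ⟩ sub σ A

infix 4 _⊢_
data _⊢_ : Fm → Fm → Set where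
  ax-id   : ∀ {A} → A ⊢ A
  ax-top  : ∀ {A} → A ⊢ ⊤'
  ax-∧l   : ∀ {A B} → A ∧' B ⊢ A
  ax-∧r   : ∀ {A B} → A ∧' B ⊢ B
  cut     : ∀ {A B C} → A ⊢ B → B ⊢ C → A ⊢ C
  ∧-intro : ∀ {A B C} → A ⊢ B → A ⊢ C → A ⊢ B ∧' C
  mono    : ∀ {A B} (a : Mod) → A ⊢ B → ⟨ a ⟩ A ⊢ ⟨ a ⟩ B
  trans4  : ∀ {A} (a : Mod) → ⟨ a ⟩ ⟨ a ⟩ A ⊢ ⟨ a ⟩ A
  ◇-mono  : ∀ {m n A} → m < n → ⟨ ◇ n ⟩ A ⊢ ⟨ ◇ m ⟩ A
  ◇-J     : ∀ {m n A B} → m < n →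
            ⟨ ◇ n ⟩ A ∧' ⟨ ◇ m ⟩ B ⊢ ⟨ ◇ n ⟩ (A ∧' ⟨ ◇ m ⟩ B)
  ∇-mono  : ∀ {m n A} → m < n → ⟨ ∇ n ⟩ A ⊢ ⟨ ∇ m ⟩ A
  ∇-J     : ∀ {m n A B} → m < n →
            ⟨ ∇ n ⟩ A ∧' ⟨ ∇ m ⟩ B ⊢ ⟨ ∇ n ⟩ (A ∧' ⟨ ∇ m ⟩ B)
  ∇-refl  : ∀ {n A} → A ⊢ ⟨ ∇ n ⟩ A
  ◇∇      : ∀ {n A} → ⟨ ◇ n ⟩ A ⊢ ⟨ ∇ n ⟩ A
  ◇∇-abs  : ∀ {m n A} → m ≤ n → ⟨ ◇ m ⟩ ⟨ ∇ n ⟩ A ⊢ ⟨ ◇ m ⟩ A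
  ∇◇-abs  : ∀ {m n A} → m ≤ n → ⟨ ∇ n ⟩ ⟨ ◇ m ⟩ A ⊢ ⟨ ◇ m ⟩ A
  subst-rule : ∀ {A B} (σ : ℕ → Fm) → A ⊢ B → sub σ A ⊢ sub σ B

_≡RC_ : Fm → Fm → Set
A ≡RC B = (A ⊢ B) × (B ⊢ A)

ModGe : ℕ → Mod → Set
ModGe n (◇ i) = n ≤ i
ModGe n (∇ i) = n ≤ i

data InF : ℕ → Fm → Set where
  top  : ∀ {n} → InF n ⊤'
  conj : ∀ {n A B} → InF n A → InF n B → InF n (A ∧' B)
  moda : ∀ {n a A} → ModGe n a → InF n A → InF n (⟨ a ⟩ A)

word : List ℕ → Fm
word [] = ⊤'
word (j ∷ js) = ⟨ ◇ j ⟩ word js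

InW : ℕ → List ℕ → Set
InW i js = All (i ≤_) js

-- ∇_n A_n ∧ ∇_{n+1} A_{n+1} ∧ ... ∧ ∇_{n+k} A_{n+k}, given the words
-- A_n, ..., A_{n+k} as a nonempty list (head A_n, tail of length k);
-- conjunction associated to the right.
nf : ℕ → List ℕ → List (List ℕ) → Fm
nf n w [] = ⟨ ∇ n ⟩ word w
nf n w (w' ∷ ws) = ⟨ ∇ n ⟩ word w ∧' nf (suc n) w' ws

nfOK : ℕ → List ℕ → List (List ℕ) → Set
nfOK n w [] = InW n w
nfOK n w (w' ∷ ws) = InW n w × nfOK (suc n) w' ws

-- Words of 𝒲ₙ are totally preordered by A <ₙ B :⇔ B ⊢ ◇ₙ A. To compare two words, let m be
-- the least index occurring in either and cut both at their first m: each word is then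
-- equivalent to its head (in 𝒲ₘ₊₁) conjoined with its tail (⊤ or ◇ₘ of a word), heads are
-- compared at level m + 1 and tails against the other word at level m, all on shorter words.
-- Totality makes ∇ₙ w ∧ ∇ₙ v equivalent to a single ∇ₙ-word, and lets ∇ₙ swallow a whole
-- normal form ∇ₙ w ∧ ∇ₙ₊₁ A ∧ … into one ∇ₙ-word. With these, normal forms are closed
-- under ∧, ◇ᵢ and ∇ᵢ for i ≥ n (peeling off one level at a time until i = n), and the
-- theorem follows by induction on the formula.
module Submission where

open import Defs
open import Data.Nat using (ℕ; suc; _+_; _<_; _≤_; s≤s; z≤n; _≤‴_; ≤‴-refl; ≤‴-step)
open import Data.Nat.Properties
  using (≤-refl; <⇒≤; <-irrefl; n<1+n; m≤n⇒m<n∨m≡n; ≤⇒≤‴; ≤‴⇒≤; +-comm; +-monoˡ-<; +-mono-<-≤; +-mono-≤-<)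
open import Data.Nat.Induction using (<-rec)
open import Induction.WellFounded using (WfRec)
open import Data.List using (List; []; _∷_; _++_; length)
open import Data.List.Properties using (length-++-≤ˡ; length-++-≤ʳ)
open import Data.List.Relation.Unary.All as All using (All; []; _∷_)
open import Data.List.Relation.Unary.All.Properties using (++⁺; ++⁻ˡ; ++⁻ʳ)
open import Data.List.Relation.Unary.Any using (here; there)
open import Data.List.Membership.Propositional using (_∈_)
open import Data.List.Membership.Propositional.Properties using (∈-++⁻)
open import Data.List.Extrema.Nat using (min; argmin-sel; min≤⊤; min≤xs)
open import Data.Product using (Σ; _×_; _,_)
open import Data.Sum using (_⊎_; inj₁; inj₂; [_,_]′)
open import Data.Empty using (⊥-elim)
open import Function using (id)
open import Relation.Binary.Structures using (IsEquivalence)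
open import Relation.Binary.PropositionalEquality using (_≡_; refl; subst)

infixr 5 _⨾_ _≡⨾_

_⨾_ : ∀ {A B C} → A ⊢ B → B ⊢ C → A ⊢ C
_⨾_ = cut

∧-mono : ∀ {A B C D} → A ⊢ B → C ⊢ D → A ∧' C ⊢ B ∧' D
∧-mono p q = ∧-intro (ax-∧l ⨾ p) (ax-∧r ⨾ q)

∧-swap : ∀ {A B} → A ∧' B ⊢ B ∧' A
∧-swap = ∧-intro ax-∧r ax-∧l

◇-≤ : ∀ {m n A} → m ≤ n → ⟨ ◇ n ⟩ A ⊢ ⟨ ◇ m ⟩ A
◇-≤ m≤n with m≤n⇒m<n∨m≡n m≤n
... | inj₁ m<n = ◇-mono m<n
... | inj₂ refl = ax-id

≡RC-isEquivalence : IsEquivalence _≡RC_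
≡RC-isEquivalence = record
  { refl  = ax-id , ax-id
  ; sym   = λ (p , q) → q , p
  ; trans = λ (p , q) (p′ , q′) → p ⨾ p′ , q′ ⨾ q
  }

module ≡RC = IsEquivalence ≡RC-isEquivalence

_≡⨾_ : ∀ {A B C} → A ≡RC B → B ≡RC C → A ≡RC C
_≡⨾_ = ≡RC.trans

∧-cong : ∀ {A B C D} → A ≡RC B → C ≡RC D → (A ∧' C) ≡RC (B ∧' D)
∧-cong (p , q) (p′ , q′) = ∧-mono p p′ , ∧-mono q q′

⟨⟩-cong : ∀ a {A B} → A ≡RC B → (⟨ a ⟩ A) ≡RC (⟨ a ⟩ B)
⟨⟩-cong a (p , q) = mono a p , mono a q

∧-assoc : ∀ {A B C} → ((A ∧' B) ∧' C) ≡RC (A ∧' (B ∧' C))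
∧-assoc = ∧-intro (ax-∧l ⨾ ax-∧l) (∧-mono ax-∧r ax-id)
        , ∧-intro (∧-mono ax-id ax-∧l) (ax-∧r ⨾ ax-∧r)

∧-interchange : ∀ {A B C D} → ((A ∧' B) ∧' (C ∧' D)) ≡RC ((A ∧' C) ∧' (B ∧' D))
∧-interchange = interchange , interchange
  where
  interchange : ∀ {A B C D} → (A ∧' B) ∧' (C ∧' D) ⊢ (A ∧' C) ∧' (B ∧' D)
  interchange = ∧-intro (∧-mono ax-∧l ax-∧l) (∧-mono ax-∧r ax-∧r)

◇∇-≡RC : ∀ {n A} → (⟨ ◇ n ⟩ ⟨ ∇ n ⟩ A) ≡RC (⟨ ◇ n ⟩ A)
◇∇-≡RC {n} = ◇∇-abs ≤-refl , mono (◇ n) ∇-refl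

∇◇-≡RC : ∀ {n A} → (⟨ ∇ n ⟩ ⟨ ◇ n ⟩ A) ≡RC (⟨ ◇ n ⟩ A)
∇◇-≡RC = ∇◇-abs ≤-refl , ∇-refl

data Tail (n : ℕ) : List ℕ → Set where
  none : Tail n []
  at   : ∀ {s} → All (n ≤_) s → Tail n (n ∷ s)

Tail⇒All : ∀ {n r} → Tail n r → All (n ≤_) r
Tail⇒All none    = []
Tail⇒All (at ws) = ≤-refl ∷ ws

data Split (n : ℕ) : List ℕ → Set where
  mkSplit : ∀ {h r} → All (n <_) h → Tail n r → Split n (h ++ r)

split : ∀ {n A} → All (n ≤_) A → Split n A
split [] = mkSplit [] none
split (n≤a ∷ wA) with m≤n⇒m<n∨m≡n n≤a
... | inj₂ refl = mkSplit [] (at wA)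
... | inj₁ n<a with split wA
...   | mkSplit qh t = mkSplit (n<a ∷ qh) t

word-++⁻ˡ : ∀ X {r} → word (X ++ r) ⊢ word X
word-++⁻ˡ []      = ax-top
word-++⁻ˡ (j ∷ X) = mono (◇ j) (word-++⁻ˡ X)

word-++⁻ʳ : ∀ {n X r} → All (n ≤_) X → Tail n r → word (X ++ r) ⊢ word r
word-++⁻ʳ _  none   = ax-top
word-++⁻ʳ [] (at _) = ax-id
word-++⁻ʳ {n} {j ∷ _} (n≤j ∷ wX) t@(at _) =
  mono (◇ j) (word-++⁻ʳ wX t) ⨾ ◇-≤ n≤j ⨾ trans4 (◇ n)

∇-tail : ∀ {n r} → Tail n r → ⟨ ∇ n ⟩ word r ⊢ word r
∇-tail none   = ax-top
∇-tail (at _) = ∇◇-abs ≤-refl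

◇-absorb-tail : ∀ {n j r X} → n < j → Tail n r → ⟨ ◇ j ⟩ X ∧' word r ⊢ ⟨ ◇ j ⟩ (X ∧' word r)
◇-absorb-tail {j = j} _ none = ax-∧l ⨾ mono (◇ j) (∧-intro ax-id ax-top)
◇-absorb-tail n<j (at _) = ◇-J n<j

∇-absorb-tail : ∀ {n j r X} → n < j → Tail n r → ⟨ ∇ j ⟩ X ∧' word r ⊢ ⟨ ∇ j ⟩ (X ∧' word r)
∇-absorb-tail {j = j} n<j t = ∧-mono ax-id ∇-refl ⨾ ∇-J n<j ⨾ mono (∇ j) (∧-mono ax-id (∇-tail t))

word-++⁺ : ∀ {n X r} → All (n <_) X → Tail n r → word X ∧' word r ⊢ word (X ++ r)
word-++⁺ [] _ = ax-∧r
word-++⁺ {X = j ∷ _} (n<j ∷ qX) t = ◇-absorb-tail n<j t ⨾ mono (◇ j) (word-++⁺ qX t)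

◇-word-++⁺ : ∀ {n X r} → All (n <_) X → Tail n r →
             ⟨ ◇ (suc n) ⟩ word X ∧' word r ⊢ ⟨ ◇ n ⟩ word (X ++ r)
◇-word-++⁺ {n} qX t = ◇-absorb-tail (n<1+n n) t ⨾ mono (◇ (suc n)) (word-++⁺ qX t) ⨾ ◇-mono (n<1+n n)

∇-word-++⁺ : ∀ {n X r} → All (n <_) X → Tail n r →
             ⟨ ∇ (suc n) ⟩ word X ∧' word r ⊢ ⟨ ∇ n ⟩ word (X ++ r)
∇-word-++⁺ {n} qX t = ∇-absorb-tail (n<1+n n) t ⨾ mono (∇ (suc n)) (word-++⁺ qX t) ⨾ ∇-mono (n<1+n n)

data Comparison (n : ℕ) (A B : List ℕ) : Set where
  less    : word B ⊢ ⟨ ◇ n ⟩ word A → Comparison n A B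
  equiv   : word A ≡RC word B → Comparison n A B
  greater : word A ⊢ ⟨ ◇ n ⟩ word B → Comparison n A B

Comparison-≤ : ∀ {m n A B} → m ≤ n → Comparison n A B → Comparison m A B
Comparison-≤ m≤n (less p)    = less (p ⨾ ◇-≤ m≤n)
Comparison-≤ _   (equiv e)   = equiv e
Comparison-≤ m≤n (greater p) = greater (p ⨾ ◇-≤ m≤n)

Comparable : ℕ → Set
Comparable k = ∀ {n A B} → length A + length B ≡ k → All (n ≤_) A → All (n ≤_) B → Comparison n A B

Comparable-swap : ∀ a b → WfRec _<_ Comparable (a + b) → WfRec _<_ Comparable (b + a)
Comparable-swap a b = subst (WfRec _<_ Comparable) (+-comm a b)

least-element : ∀ x xs → Σ ℕ λ m → m ∈ x ∷ xs × All (m ≤_) (x ∷ xs)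
least-element x xs = min x xs , [ here , there ]′ (argmin-sel id x xs) , min≤⊤ x xs ∷ min≤xs x xs

prefix-shorter : ∀ {m h r} → m ∈ h ++ r → All (m <_) h → length h < length (h ++ r)
prefix-shorter {h = []} (here _)  [] = s≤s z≤n
prefix-shorter {h = []} (there _) [] = s≤s z≤n
prefix-shorter (here refl) (m<m ∷ _) = ⊥-elim (<-irrefl refl m<m)
prefix-shorter (there m∈) (_ ∷ qh)   = s≤s (prefix-shorter m∈ qh)

tail-below-or-greater : ∀ {n h r B} → WfRec _<_ Comparable (length (h ++ r) + length B) →
  All (n <_) h → Tail n r → All (n ≤_) B →
  (word B ⊢ word r) ⊎ (word (h ++ r) ⊢ ⟨ ◇ n ⟩ word B)
tail-below-or-greater _ _ none _ = inj₁ ax-top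
tail-below-or-greater {n} {h} {_} {B} ih qh t@(at {s} ws) wB
  with ih (+-monoˡ-< (length B) (length-++-≤ʳ (n ∷ s) {h})) refl ws wB
... | less B⊢◇s       = inj₁ B⊢◇s
... | equiv (s⊢B , _) = inj₂ (word-++⁻ʳ (All.map <⇒≤ qh) t ⨾ mono (◇ n) s⊢B)
... | greater s⊢◇B    = inj₂ (word-++⁻ʳ (All.map <⇒≤ qh) t ⨾ mono (◇ n) s⊢◇B ⨾ trans4 (◇ n))

compare-heads : ∀ {n hA rA hB rB} → All (n <_) hA → Tail n rA → All (n <_) hB → Tail n rB →
  word (hB ++ rB) ⊢ word rA → word (hA ++ rA) ⊢ word rB →
  Comparison (suc n) hA hB → Comparison n (hA ++ rA) (hB ++ rB)
compare-heads {hB = hB} qA tA _ _ B⊢rA _ (less hB⊢◇hA) =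
  less (∧-intro (word-++⁻ˡ hB ⨾ hB⊢◇hA) B⊢rA ⨾ ◇-word-++⁺ qA tA)
compare-heads {hA = hA} {hB = hB} qA tA qB tB B⊢rA A⊢rB (equiv (hA⊢hB , hB⊢hA)) =
  equiv ( ∧-intro (word-++⁻ˡ hA ⨾ hA⊢hB) A⊢rB ⨾ word-++⁺ qB tB
        , ∧-intro (word-++⁻ˡ hB ⨾ hB⊢hA) B⊢rA ⨾ word-++⁺ qA tA )
compare-heads {hA = hA} _ _ qB tB _ A⊢rB (greater hA⊢◇hB) =
  greater (∧-intro (word-++⁻ˡ hA ⨾ hA⊢◇hB) A⊢rB ⨾ ◇-word-++⁺ qB tB)

compare-split : ∀ {n hA rA hB rB} →
  WfRec _<_ Comparable (length (hA ++ rA) + length (hB ++ rB)) →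
  length hA + length hB < length (hA ++ rA) + length (hB ++ rB) →
  All (n <_) hA → Tail n rA → All (n <_) hB → Tail n rB →
  All (n ≤_) (hA ++ rA) → All (n ≤_) (hB ++ rB) → Comparison n (hA ++ rA) (hB ++ rB)
compare-split {hA = hA} {rA} {hB} {rB} ih heads< qA tA qB tB wA wB
  with tail-below-or-greater ih qA tA wB
     | tail-below-or-greater (Comparable-swap (length (hA ++ rA)) (length (hB ++ rB)) ih) qB tB wA
... | inj₂ A⊢◇B | _         = greater A⊢◇B
... | inj₁ _    | inj₂ B⊢◇A = less B⊢◇A
... | inj₁ B⊢rA | inj₁ A⊢rB = compare-heads qA tA qB tB B⊢rA A⊢rB (ih heads< refl qA qB)

compare-at-least : ∀ {m A B} → WfRec _<_ Comparable (length A + length B) →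
  m ∈ A ++ B → All (m ≤_) A → All (m ≤_) B → Comparison m A B
compare-at-least ih m∈AB wA wB with split wA | split wB
... | mkSplit {hA} qA tA | mkSplit {hB} qB tB = compare-split ih heads< qA tA qB tB wA wB
  where
  heads< : length hA + length hB < _
  heads< with ∈-++⁻ (hA ++ _) m∈AB
  ... | inj₁ m∈A = +-mono-<-≤ (prefix-shorter m∈A qA) (length-++-≤ˡ hB)
  ... | inj₂ m∈B = +-mono-≤-< (length-++-≤ˡ hA) (prefix-shorter m∈B qB)

compare-step : ∀ k → WfRec _<_ Comparable k → Comparable k
compare-step _ _ {A = []} {B = []} refl _ _ = equiv ≡RC.refl
compare-step _ _ {A = []} {B = b ∷ _} refl _ (n≤b ∷ _) = less (mono (◇ b) ax-top ⨾ ◇-≤ n≤b)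
compare-step _ _ {A = a ∷ _} {B = []} refl (n≤a ∷ _) _ = greater (mono (◇ a) ax-top ⨾ ◇-≤ n≤a)
compare-step _ ih {A = A@(a ∷ A′)} {B = B@(_ ∷ _)} refl wA wB with least-element a (A′ ++ B)
... | m , m∈AB , m≤AB =
  Comparison-≤ (All.lookup (++⁺ wA wB) m∈AB) (compare-at-least ih m∈AB (++⁻ˡ A m≤AB) (++⁻ʳ A m≤AB))

compare : ∀ {n A B} → All (n ≤_) A → All (n ≤_) B → Comparison n A B
compare = <-rec Comparable compare-step _ refl

∇-total : ∀ {n A B} → All (n ≤_) A → All (n ≤_) B →
          (word A ⊢ ⟨ ∇ n ⟩ word B) ⊎ (word B ⊢ ⟨ ∇ n ⟩ word A)
∇-total wA wB with compare wA wB
... | less B⊢◇A       = inj₂ (B⊢◇A ⨾ ◇∇)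
... | equiv (A⊢B , _) = inj₁ (A⊢B ⨾ ∇-refl)
... | greater A⊢◇B    = inj₁ (A⊢◇B ⨾ ◇∇)

HasNF : ℕ → Fm → Set
HasNF n A = Σ (List ℕ) λ w → Σ (List (List ℕ)) λ ws → nfOK n w ws × (A ≡RC nf n w ws)

HasWordNF : ℕ → Fm → Set
HasWordNF n A = Σ (List ℕ) λ y → InW n y × (A ≡RC (⟨ ∇ n ⟩ word y))

HasNF-resp : ∀ {n A B} → A ≡RC B → HasNF n B → HasNF n A
HasNF-resp e (w , ws , ok , e′) = w , ws , ok , e ≡⨾ e′

nfOK-head : ∀ {n w} ws → nfOK n w ws → InW n w
nfOK-head []      ok      = ok
nfOK-head (_ ∷ _) (ok , _) = ok

nf-uncons : ∀ {n w} ws → nfOK n w ws →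
  Σ (List ℕ) λ w′ → Σ (List (List ℕ)) λ ws′ →
    nfOK (suc n) w′ ws′ × (nf n w ws ≡RC (⟨ ∇ n ⟩ word w ∧' nf (suc n) w′ ws′))
nf-uncons []        _        = [] , [] , [] , ∧-intro ax-id (ax-top ⨾ ∇-refl) , ax-∧l
nf-uncons (w′ ∷ ws) (_ , ok) = w′ , ws , ok , ≡RC.refl

∇-∧-HasNF : ∀ {n u T} → InW n u → HasNF (suc n) T → HasNF n (⟨ ∇ n ⟩ word u ∧' T)
∇-∧-HasNF qu (w , ws , ok , e) = _ , w ∷ ws , (qu , ok) , ∧-cong ≡RC.refl e

∇-∧-∇ : ∀ {n w v} → InW n w → InW n v → HasWordNF n (⟨ ∇ n ⟩ word w ∧' ⟨ ∇ n ⟩ word v)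
∇-∧-∇ {n} {w} {v} qw qv with ∇-total qw qv
... | inj₁ w⊢∇v = w , qw , ax-∧l , ∧-intro ax-id (mono (∇ n) w⊢∇v ⨾ trans4 (∇ n))
... | inj₂ v⊢∇w = v , qv , ax-∧r , ∧-intro (mono (∇ n) v⊢∇w ⨾ trans4 (∇ n)) ax-id

∇-∧-∇suc : ∀ {n w z} → InW n w → InW (suc n) z →
           HasWordNF n (⟨ ∇ n ⟩ (⟨ ∇ n ⟩ word w ∧' ⟨ ∇ (suc n) ⟩ word z))
∇-∧-∇suc {n} {z = z} qw qz with split qw
... | mkSplit {h} {r} qh t with ∇-total qh qz
...   | inj₁ h⊢∇z =
        h ++ r , qw , mono (∇ n) ax-∧l ⨾ trans4 (∇ n) , mono (∇ n) (∧-intro ∇-refl (word-++⁻ˡ h ⨾ h⊢∇z))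
...   | inj₂ z⊢∇h =
        z ++ r , ++⁺ (All.map <⇒≤ qz) (Tail⇒All t) , mono (∇ n) to ⨾ trans4 (∇ n) , mono (∇ n) from
  where
  to : ⟨ ∇ n ⟩ word (h ++ r) ∧' ⟨ ∇ (suc n) ⟩ word z ⊢ ⟨ ∇ n ⟩ word (z ++ r)
  to = ∧-intro ax-∧r (ax-∧l ⨾ mono (∇ n) (word-++⁻ʳ (All.map <⇒≤ qh) t) ⨾ ∇-tail t) ⨾ ∇-word-++⁺ qz t
  from : word (z ++ r) ⊢ ⟨ ∇ n ⟩ word (h ++ r) ∧' ⟨ ∇ (suc n) ⟩ word z
  from = ∧-intro (∧-intro (word-++⁻ˡ z ⨾ z⊢∇h) (word-++⁻ʳ (All.map <⇒≤ qz) t) ⨾ ∇-word-++⁺ qh t)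
                 (word-++⁻ˡ z ⨾ ∇-refl)

inner-∇-absorb : ∀ {n k X Y} → n < k → (⟨ ∇ n ⟩ (⟨ ∇ n ⟩ X ∧' ⟨ ∇ k ⟩ Y)) ≡RC (⟨ ∇ n ⟩ (⟨ ∇ n ⟩ X ∧' Y))
inner-∇-absorb {n} n<k =
    mono (∇ n) (∧-swap ⨾ ∇-J n<k ⨾ ∇-mono n<k ⨾ mono (∇ n) ∧-swap) ⨾ trans4 (∇ n)
  , mono (∇ n) (∧-mono ax-id ∇-refl)

∇-nf-word : ∀ {n w} ws → nfOK n w ws → HasWordNF n (⟨ ∇ n ⟩ nf n w ws)
∇-nf-word {n} {w} [] ok = w , ok , trans4 (∇ n) , ∇-refl
∇-nf-word {n} (_ ∷ ws) (qw , ok) with ∇-nf-word ws ok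
... | z , qz , e with ∇-∧-∇suc qw qz
...   | y , qy , e′ = y , qy , ≡RC.sym (inner-∇-absorb (n<1+n n)) ≡⨾ ⟨⟩-cong (∇ n) (∧-cong ≡RC.refl e) ≡⨾ e′

∇-distrib : ∀ {n m X Y} → n < m → (⟨ ∇ m ⟩ (⟨ ∇ n ⟩ X ∧' Y)) ≡RC (⟨ ∇ n ⟩ X ∧' ⟨ ∇ m ⟩ Y)
∇-distrib {n} {m} n<m =
    ∧-intro (mono (∇ m) ax-∧l ⨾ ∇-mono n<m ⨾ trans4 (∇ n)) (mono (∇ m) ax-∧r)
  , ∧-swap ⨾ ∇-J n<m ⨾ mono (∇ m) ∧-swap

◇-distrib : ∀ {n m X Y} → n < m → (⟨ ◇ m ⟩ (⟨ ∇ n ⟩ X ∧' Y)) ≡RC (⟨ ∇ n ⟩ ⟨ ◇ n ⟩ X ∧' ⟨ ◇ m ⟩ Y)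
◇-distrib {n} {m} n<m =
    ∧-intro (mono (◇ m) ax-∧l ⨾ ◇-mono n<m ⨾ ◇∇-abs ≤-refl ⨾ ∇-refl) (mono (◇ m) ax-∧r)
  , ∧-intro ax-∧r (ax-∧l ⨾ ∇◇-abs ≤-refl) ⨾ ◇-J n<m ⨾ mono (◇ m) (∧-intro (ax-∧r ⨾ ◇∇) ax-∧l)

-- Recursion is on the gap n ≤‴ m rather than on ws: nf-uncons pads a one-word normal form
-- with ∇ₙ₊₁ ⊤, so the tail need not get shorter.
∇-nf : ∀ {n m w} ws → n ≤‴ m → nfOK n w ws → HasNF n (⟨ ∇ m ⟩ nf n w ws)
∇-nf ws ≤‴-refl ok with ∇-nf-word ws ok
... | y , qy , e = y , [] , qy , e
∇-nf ws (≤‴-step n<m) ok with nf-uncons ws ok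
... | _ , ws′ , ok′ , e =
  HasNF-resp (⟨⟩-cong (∇ _) e ≡⨾ ∇-distrib (≤‴⇒≤ n<m)) (∇-∧-HasNF (nfOK-head ws ok) (∇-nf ws′ n<m ok′))

◇-nf : ∀ {n m w} ws → n ≤‴ m → nfOK n w ws → HasNF n (⟨ ◇ m ⟩ nf n w ws)
◇-nf {n} ws ≤‴-refl ok with ∇-nf-word ws ok
... | y , qy , e = n ∷ y , [] , ≤-refl ∷ qy ,
                   ≡RC.sym ◇∇-≡RC ≡⨾ ⟨⟩-cong (◇ n) e ≡⨾ ◇∇-≡RC ≡⨾ ≡RC.sym ∇◇-≡RC
◇-nf ws (≤‴-step n<m) ok with nf-uncons ws ok
... | _ , ws′ , ok′ , e =
  HasNF-resp (⟨⟩-cong (◇ _) e ≡⨾ ◇-distrib (≤‴⇒≤ n<m))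
             (∇-∧-HasNF (≤-refl ∷ nfOK-head ws ok) (◇-nf ws′ n<m ok′))

nf-∧-nf : ∀ {n w v} ws vs → nfOK n w ws → nfOK n v vs → HasNF n (nf n w ws ∧' nf n v vs)
nf-∧-nf [] vs qw okv with nf-uncons vs okv | ∇-∧-∇ qw (nfOK-head vs okv)
... | v′ , vs′ , okv′ , e | u , qu , e′ =
  HasNF-resp (∧-cong ≡RC.refl e ≡⨾ ≡RC.sym ∧-assoc ≡⨾ ∧-cong e′ ≡RC.refl)
             (u , v′ ∷ vs′ , (qu , okv′) , ≡RC.refl)
nf-∧-nf (_ ∷ ws) vs (qw , okw) okv with nf-uncons vs okv | ∇-∧-∇ qw (nfOK-head vs okv)
... | _ , vs′ , okv′ , e | u , qu , e′ =
  HasNF-resp (∧-cong ≡RC.refl e ≡⨾ ∧-interchange ≡⨾ ∧-cong e′ ≡RC.refl)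
             (∇-∧-HasNF qu (nf-∧-nf ws vs′ okw okv′))

HasNF-∧ : ∀ {n A B} → HasNF n A → HasNF n B → HasNF n (A ∧' B)
HasNF-∧ (_ , ws , ok , e) (_ , vs , ok′ , e′) = HasNF-resp (∧-cong e e′) (nf-∧-nf ws vs ok ok′)

HasNF-◇ : ∀ {n i A} → n ≤ i → HasNF n A → HasNF n (⟨ ◇ i ⟩ A)
HasNF-◇ n≤i (_ , ws , ok , e) = HasNF-resp (⟨⟩-cong (◇ _) e) (◇-nf ws (≤⇒≤‴ n≤i) ok)

HasNF-∇ : ∀ {n i A} → n ≤ i → HasNF n A → HasNF n (⟨ ∇ i ⟩ A)
HasNF-∇ n≤i (_ , ws , ok , e) = HasNF-resp (⟨⟩-cong (∇ _) e) (∇-nf ws (≤⇒≤‴ n≤i) ok)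

theorem3 : (n : ℕ) (A : Fm) → InF n A →
    Σ (List ℕ) λ w → Σ (List (List ℕ)) λ ws →
    nfOK n w ws × (A ≡RC nf n w ws)
theorem3 n ⊤'           top          = [] , [] , [] , ∇-refl , ax-top
theorem3 n (A ∧' B)     (conj p q)   = HasNF-∧ (theorem3 n A p) (theorem3 n B q)
theorem3 n (⟨ ◇ i ⟩ A) (moda n≤i p) = HasNF-◇ n≤i (theorem3 n A p)
theorem3 n (⟨ ∇ i ⟩ A) (moda n≤i p) = HasNF-∇ n≤i (theorem3 n A p)
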